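{- Let $k,m,n$ be non-negative integers with $k+m=n$. The number $|\Omega^0_{k,m}|$ of complete configurations of length $n$ having $k$ black and $m$ white particles in the top row, and $m$ black and $k$ white particles in the bottom row, equals $$\frac{1}{n+1}\binom{n+1}{k}\binom{n+1}{m}.$$
   Context: A complete configuration of length $n$ is a pair of rows (top and bottom) of $n$ cells each, every cell containing either a black particle or a white particle, subject to: (i) balance: the two rows together contain exactly $n$ black and $n$ white particles; (ii) positivity: for every $j\in\{0,\dots,n\}$, among the particles in the first $j$ columns (both rows, counted from the left) there are at least as many black as white particles. -}

module Defs where

open import Data.Nat using (ℕ; zero; suc; _+_; _≤ᵇ_)
open import Data.Bool using (Bool; true; false; _∧_; if_then_else_)
open import Data.Vec using (Vec; []; _∷_; take; toList)
open import Data.List using (List; []; _∷_; concatMap; map; filter; length; upTo)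
open import Data.Bool.ListAction using (and)
open import Data.Product using (_×_; _,_)

-- A particle colour: true = black, false = white.
Colour : Set
Colour = Bool

-- A configuration of length n: top row and bottom row, each n cells.
Config : ℕ → Set
Config n = Vec Colour n × Vec Colour n

blacks : ∀ {n} → Vec Colour n → ℕ
blacks [] = 0
blacks (true ∷ v) = suc (blacks v)
blacks (false ∷ v) = blacks v

whites : ∀ {n} → Vec Colour n → ℕ
whites [] = 0
whites (true ∷ v) = whites v
whites (false ∷ v) = suc (whites v)

-- prefix of the first j columns of a row (j ≤ n; for j > n the whole row)
prefix : ∀ {n} → ℕ → Vec Colour n → List Colour
prefix j v = go j (toList v)
  where
  go : ℕ → List Colour → List Colour
  go zero _ = []
  go (suc j) [] = []
  go (suc j) (x ∷ xs) = x ∷ go j xs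

blacksL : List Colour → ℕ
blacksL [] = 0
blacksL (true ∷ v) = suc (blacksL v)
blacksL (false ∷ v) = blacksL v

whitesL : List Colour → ℕ
whitesL [] = 0
whitesL (true ∷ v) = whitesL v
whitesL (false ∷ v) = suc (whitesL v)

positiveᵇ : ∀ {n} → Config n → Bool
positiveᵇ {n} (t , b) =
  and (map (λ j → (whitesL (prefix j t) + whitesL (prefix j b))
             ≤ᵇ (blacksL (prefix j t) + blacksL (prefix j b)))
      (upTo (suc n)))

-- the configuration class Ω⁰_{k,m} (with k + m = n): top row has k black and
-- m white, bottom row has m black and k white (this already gives balance (i)),
-- and positivity holds.
open import Data.Nat using (_≡ᵇ_)

inΩ⁰ᵇ : ∀ {n} → ℕ → ℕ → Config n → Bool
inΩ⁰ᵇ k m (t , b) =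
  (blacks t ≡ᵇ k) ∧ (whites t ≡ᵇ m) ∧ (blacks b ≡ᵇ m) ∧ (whites b ≡ᵇ k)
  ∧ ((blacks t + blacks b) ≡ᵇ (whites t + whites b))
  ∧ positiveᵇ (t , b)

-- exhaustive enumeration of all rows of length n (each exactly once)
allRows : (n : ℕ) → List (Vec Colour n)
allRows zero = [] ∷ []
allRows (suc n) = concatMap (λ v → (true ∷ v) ∷ (false ∷ v) ∷ []) (allRows n)

allConfigs : (n : ℕ) → List (Config n)
allConfigs n = concatMap (λ t → map (λ b → (t , b)) (allRows n)) (allRows n)

countΩ⁰ : (n k m : ℕ) → ℕ
countΩ⁰ n k m = length (Data.List.filterᵇ (inΩ⁰ᵇ k m) (allConfigs n))

-- Read column by column, the surplus of black over white particles changes by +2, 0, 0 or −2, so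
-- positivity says that the walk of half-surpluses started at 0 never goes below 0. Removing the first
-- column and applying Pascal's rule to every binomial coefficient proves by induction on n that, for
-- n ≤ h + a + c, the pairs of rows with a and c black particles whose walk starts at h and stays
-- nonnegative number (n C a)(n C c) − (n C (h + a + 1))(n C (h + c + 1)). At h = 0, a = k, c = m the
-- absorption identity (k + 1)·((n + 1) C (k + 1)) = (n + 1)·(n C k) turns this difference into
-- ((n + 1) C k)((n + 1) C m)/(n + 1).

module Submission where

open import Defs
open import Data.Bool.Base using (Bool; true; false; _∧_; T)
open import Data.Bool.ListAction using (and)
open import Data.Bool.Properties using (∧-zeroʳ; T-≡)
open import Data.List.Base using (List; []; _∷_; _++_; map; concatMap; filterᵇ; length; applyUpTo)
open import Data.List.Properties using (map-cong; map-∘; map-++; map-applyUpTo)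
open import Data.Nat.Base
open import Data.Nat.Combinatorics using (_C_; nCk+nC[k+1]≡[n+1]C[k+1]; k>n⇒nCk≡0; nC1≡n; nCk≡nC[n∸k])
open import Data.Nat.DivMod using (_/_; m*n/n≡m)
open import Data.Nat.ListAction using (sum)
open import Data.Nat.ListAction.Properties using (sum-++)
open import Data.Nat.Properties
open import Data.Nat.Tactic.RingSolver using (solve-∀)
open import Data.Product.Base using (_,_)
open import Data.Vec.Base using (Vec; []; _∷_)
open import Function.Base using (_∘_)
open import Function.Bundles using (Equivalence; mk⇔)
open import Relation.Binary.PropositionalEquality
open import Relation.Nullary.Decidable using (does-⇔)
open import Algebra.Properties.CommutativeSemigroup +-commutativeSemigroup using (interchange)

private
  variable
    A B : Set
    n : ℕ

𝟙 : Bool → ℕ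
𝟙 true  = 1
𝟙 false = 0

length-filterᵇ : (p : A → Bool) (xs : List A) → length (filterᵇ p xs) ≡ sum (map (𝟙 ∘ p) xs)
length-filterᵇ p []       = refl
length-filterᵇ p (x ∷ xs) with p x
... | true  = cong suc (length-filterᵇ p xs)
... | false = length-filterᵇ p xs

sum-map-+ : (f g : A → ℕ) (xs : List A) →
            sum (map (λ x → f x + g x) xs) ≡ sum (map f xs) + sum (map g xs)
sum-map-+ f g []       = refl
sum-map-+ f g (x ∷ xs) = begin
  f x + g x + sum (map (λ x → f x + g x) xs)       ≡⟨ cong (f x + g x +_) (sum-map-+ f g xs) ⟩
  f x + g x + (sum (map f xs) + sum (map g xs))    ≡⟨ interchange (f x) (g x) _ _ ⟩
  f x + sum (map f xs) + (g x + sum (map g xs))    ∎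
  where open ≡-Reasoning

sum-map-concatMap : (f : B → ℕ) (g : A → List B) (xs : List A) →
                    sum (map f (concatMap g xs)) ≡ sum (map (λ x → sum (map f (g x))) xs)
sum-map-concatMap f g []       = refl
sum-map-concatMap f g (x ∷ xs) = begin
  sum (map f (g x ++ concatMap g xs))              ≡⟨ cong sum (map-++ f (g x) _) ⟩
  sum (map f (g x) ++ map f (concatMap g xs))      ≡⟨ sum-++ (map f (g x)) _ ⟩
  sum (map f (g x)) + sum (map f (concatMap g xs)) ≡⟨ cong (sum (map f (g x)) +_) (sum-map-concatMap f g xs) ⟩
  sum (map f (g x)) + sum (map (λ x → sum (map f (g x))) xs) ∎
  where open ≡-Reasoning

sum-map-zero : {f : A → ℕ} → (∀ x → f x ≡ 0) → (xs : List A) → sum (map f xs) ≡ 0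
sum-map-zero f≡0 []       = refl
sum-map-zero f≡0 (x ∷ xs) = cong₂ _+_ (f≡0 x) (sum-map-zero f≡0 xs)

applyUpTo-cong : {f g : ℕ → A} → (∀ j → f j ≡ g j) → ∀ n → applyUpTo f n ≡ applyUpTo g n
applyUpTo-cong f≡g zero    = refl
applyUpTo-cong f≡g (suc n) = cong₂ _∷_ (f≡g 0) (applyUpTo-cong (f≡g ∘ suc) n)

≤ᵇ-suc : ∀ m n → (suc m ≤ᵇ suc n) ≡ (m ≤ᵇ n)
≤ᵇ-suc zero    n = refl
≤ᵇ-suc (suc m) n = refl

≤ᵇ-cong-suc : ∀ {m m′ n n′} → m ≡ suc m′ → n ≡ suc n′ → (m ≤ᵇ n) ≡ (m′ ≤ᵇ n′)
≤ᵇ-cong-suc {m′ = m′} {n′ = n′} refl refl = ≤ᵇ-suc m′ n′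

∧-redundant : ∀ x y {z} w → (T x → T y → T z) → x ∧ x ∧ y ∧ y ∧ z ∧ w ≡ x ∧ y ∧ w
∧-redundant false y     w _    = refl
∧-redundant true  false w _    = refl
∧-redundant true  true  w x∧y⇒z = cong (_∧ w) (Equivalence.to T-≡ (x∧y⇒z _ _))

Σrows : (n : ℕ) → (Vec Colour n → ℕ) → ℕ
Σrows n f = sum (map f (allRows n))

Σrows-cong : {f g : Vec Colour n → ℕ} → (∀ v → f v ≡ g v) → Σrows n f ≡ Σrows n g
Σrows-cong {n} f≡g = cong sum (map-cong f≡g (allRows n))

Σrows-suc : (f : Vec Colour (suc n) → ℕ) →
            Σrows (suc n) f ≡ Σrows n (f ∘ (true ∷_)) + Σrows n (f ∘ (false ∷_))
Σrows-suc {n} f = begin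
  Σrows (suc n) f
    ≡⟨ sum-map-concatMap f _ (allRows n) ⟩
  Σrows n (λ v → f (true ∷ v) + (f (false ∷ v) + 0))
    ≡⟨ Σrows-cong (λ v → cong (f (true ∷ v) +_) (+-identityʳ _)) ⟩
  Σrows n (λ v → f (true ∷ v) + f (false ∷ v))
    ≡⟨ sum-map-+ _ _ (allRows n) ⟩
  Σrows n (f ∘ (true ∷_)) + Σrows n (f ∘ (false ∷_)) ∎
  where open ≡-Reasoning

Σconfigs : (n : ℕ) → (Config n → ℕ) → ℕ
Σconfigs n F = Σrows n (λ t → Σrows n (λ b → F (t , b)))

Σconfigs-cong : {F G : Config n → ℕ} → (∀ p → F p ≡ G p) → Σconfigs n F ≡ Σconfigs n G
Σconfigs-cong F≡G = Σrows-cong (λ t → Σrows-cong (λ b → F≡G (t , b)))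

Σconfigs-zero : {F : Config n → ℕ} → (∀ p → F p ≡ 0) → Σconfigs n F ≡ 0
Σconfigs-zero {n} F≡0 = sum-map-zero (λ t → sum-map-zero (λ b → F≡0 (t , b)) (allRows n)) (allRows n)

consColumn : Colour → Colour → Config n → Config (suc n)
consColumn x y (t , b) = x ∷ t , y ∷ b

Σconfigs-suc : (F : Config (suc n) → ℕ) →
  Σconfigs (suc n) F ≡ Σconfigs n (F ∘ consColumn true true) + Σconfigs n (F ∘ consColumn true false)
                     + Σconfigs n (F ∘ consColumn false true) + Σconfigs n (F ∘ consColumn false false)
Σconfigs-suc {n} F = begin
  Σconfigs (suc n) F
    ≡⟨ Σrows-suc (λ t → Σrows (suc n) (λ b → F (t , b))) ⟩
  Σrows n (λ t → Σrows (suc n) (λ b → F (true ∷ t , b)))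
    + Σrows n (λ t → Σrows (suc n) (λ b → F (false ∷ t , b)))
    ≡⟨ cong₂ _+_ (split true) (split false) ⟩
  (●● + ●○) + (○● + ○○)
    ≡⟨ +-assoc (●● + ●○) ○● ○○ ⟨
  ●● + ●○ + ○● + ○○ ∎
  where
  open ≡-Reasoning
  ●● ●○ ○● ○○ : ℕ
  ●● = Σconfigs n (F ∘ consColumn true true)
  ●○ = Σconfigs n (F ∘ consColumn true false)
  ○● = Σconfigs n (F ∘ consColumn false true)
  ○○ = Σconfigs n (F ∘ consColumn false false)
  split : ∀ x → Σrows n (λ t → Σrows (suc n) (λ b → F (x ∷ t , b)))
              ≡ Σconfigs n (F ∘ consColumn x true) + Σconfigs n (F ∘ consColumn x false)
  split x = trans (Σrows-cong (λ t → Σrows-suc (λ b → F (x ∷ t , b)))) (sum-map-+ _ _ (allRows n))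

countΩ⁰≡Σconfigs : ∀ n k m → countΩ⁰ n k m ≡ Σconfigs n (𝟙 ∘ inΩ⁰ᵇ k m)
countΩ⁰≡Σconfigs n k m = begin
  countΩ⁰ n k m
    ≡⟨ length-filterᵇ _ (allConfigs n) ⟩
  sum (map (𝟙 ∘ inΩ⁰ᵇ k m) (allConfigs n))
    ≡⟨ sum-map-concatMap _ _ (allRows n) ⟩
  Σrows n (λ t → sum (map (𝟙 ∘ inΩ⁰ᵇ k m) (map (t ,_) (allRows n))))
    ≡⟨ Σrows-cong {n} (λ t → cong sum (map-∘ (allRows n))) ⟨
  Σconfigs n (𝟙 ∘ inΩ⁰ᵇ k m) ∎
  where open ≡-Reasoning

-- s is a surplus of black particles placed in front of the configuration:
-- surplus 2h amounts to starting the column walk at height h.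
prefixPositiveᵇ : ℕ → Config n → ℕ → Bool
prefixPositiveᵇ s (t , b) j =
  whitesL (prefix j t) + whitesL (prefix j b) ≤ᵇ s + (blacksL (prefix j t) + blacksL (prefix j b))

positiveWithᵇ : ℕ → Config n → Bool
positiveWithᵇ {n} s p = and (applyUpTo (prefixPositiveᵇ s p) (suc n))

positiveᵇ≡positiveWithᵇ0 : (p : Config n) → positiveᵇ p ≡ positiveWithᵇ 0 p
positiveᵇ≡positiveWithᵇ0 {n} p = cong and (map-applyUpTo (λ j → j) (prefixPositiveᵇ 0 p) (suc n))

-- The empty prefix is always positive, so only the prefixes through the first column matter.
positiveWithᵇ-consColumn : ∀ s s′ x y (p : Config n) →
  (∀ j → prefixPositiveᵇ s (consColumn x y p) (suc j) ≡ prefixPositiveᵇ s′ p j) →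
  positiveWithᵇ s (consColumn x y p) ≡ positiveWithᵇ s′ p
positiveWithᵇ-consColumn {n} s s′ x y p step = cong and (applyUpTo-cong step (suc n))

positiveWithᵇ-●● : ∀ s (p : Config n) → positiveWithᵇ s (consColumn true true p) ≡ positiveWithᵇ (2 + s) p
positiveWithᵇ-●● s (t , b) = positiveWithᵇ-consColumn s (2 + s) true true (t , b) λ j →
  cong (whitesL (prefix j t) + whitesL (prefix j b) ≤ᵇ_)
       (surplus s (blacksL (prefix j t)) (blacksL (prefix j b)))
  where
  surplus : ∀ s x y → s + (suc x + suc y) ≡ 2 + s + (x + y)
  surplus = solve-∀

positiveWithᵇ-●○ : ∀ s (p : Config n) → positiveWithᵇ s (consColumn true false p) ≡ positiveWithᵇ s p
positiveWithᵇ-●○ s (t , b) = positiveWithᵇ-consColumn s s true false (t , b) λ j →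
  ≤ᵇ-cong-suc (+-suc (whitesL (prefix j t)) _) (+-suc s _)

positiveWithᵇ-○● : ∀ s (p : Config n) → positiveWithᵇ s (consColumn false true p) ≡ positiveWithᵇ s p
positiveWithᵇ-○● s (t , b) = positiveWithᵇ-consColumn s s false true (t , b) λ j →
  ≤ᵇ-cong-suc refl (trans (cong (s +_) (+-suc (blacksL (prefix j t)) _)) (+-suc s _))

positiveWithᵇ-○○ : ∀ s (p : Config n) → positiveWithᵇ (2 + s) (consColumn false false p) ≡ positiveWithᵇ s p
positiveWithᵇ-○○ s (t , b) = positiveWithᵇ-consColumn (2 + s) s false false (t , b) λ j →
  trans (≤ᵇ-cong-suc (cong suc (+-suc (whitesL (prefix j t)) _)) refl)
        (≤ᵇ-suc (whitesL (prefix j t) + whitesL (prefix j b)) _)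

inΩᵇ : ℕ → ℕ → ℕ → Config n → Bool
inΩᵇ s a c (t , b) = (blacks t ≡ᵇ a) ∧ (blacks b ≡ᵇ c) ∧ positiveWithᵇ s (t , b)

#Ω : (n s a c : ℕ) → ℕ
#Ω n s a c = Σconfigs n (𝟙 ∘ inΩᵇ s a c)

#Ω-first : Colour → Colour → (n s a c : ℕ) → ℕ
#Ω-first x y n s a c = Σconfigs n (𝟙 ∘ inΩᵇ s a c ∘ consColumn x y)

#Ω-suc : ∀ n s a c → #Ω (suc n) s a c ≡ #Ω-first true true n s a c + #Ω-first true false n s a c
                                      + #Ω-first false true n s a c + #Ω-first false false n s a c
#Ω-suc n s a c = Σconfigs-suc {n} (𝟙 ∘ inΩᵇ s a c)

≡ᵇ-blacks-∷ : ∀ x (v : Vec Colour n) a → (blacks (x ∷ v) ≡ᵇ 𝟙 x + a) ≡ (blacks v ≡ᵇ a)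
≡ᵇ-blacks-∷ true  v a = refl
≡ᵇ-blacks-∷ false v a = refl

#Ω-first-reduce : ∀ x y n s s′ a c →
                  (∀ (p : Config n) → positiveWithᵇ s (consColumn x y p) ≡ positiveWithᵇ s′ p) →
                  #Ω-first x y n s (𝟙 x + a) (𝟙 y + c) ≡ #Ω n s′ a c
#Ω-first-reduce x y n s s′ a c step = Σconfigs-cong λ (t , b) →
  cong 𝟙 (cong₂ _∧_ (≡ᵇ-blacks-∷ x t a) (cong₂ _∧_ (≡ᵇ-blacks-∷ y b c) (step (t , b))))

#Ω-first-●-top≡0 : ∀ y n s c → #Ω-first true y n s 0 c ≡ 0
#Ω-first-●-top≡0 y n s c = Σconfigs-zero {n} λ _ → refl

#Ω-first-●-bottom≡0 : ∀ x n s a → #Ω-first x true n s a 0 ≡ 0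
#Ω-first-●-bottom≡0 x n s a = Σconfigs-zero {n} λ (t , b) → cong 𝟙 (∧-zeroʳ (blacks (x ∷ t) ≡ᵇ a))

#Ω-first-○○≡0 : ∀ n a c → #Ω-first false false n 0 a c ≡ 0
#Ω-first-○○≡0 n a c = Σconfigs-zero {n} λ (t , b) →
  cong 𝟙 (trans (cong ((blacks t ≡ᵇ a) ∧_) (∧-zeroʳ (blacks b ≡ᵇ c))) (∧-zeroʳ (blacks t ≡ᵇ a)))

-- n C (k ∸ 1), except that it vanishes at k = 0, so that Pascal's rule holds for every k.
infixl 6.5 _C⁻_
_C⁻_ : ℕ → ℕ → ℕ
n C⁻ zero  = 0
n C⁻ suc k = n C k

pascal : ∀ n k → suc n C k ≡ n C⁻ k + n C k
pascal n zero    = refl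
pascal n (suc k) = sym (nCk+nC[k+1]≡[n+1]C[k+1] n k)

n≤k⇒nC[1+k]≡0 : ∀ {n k} → n ≤ k → n C suc k ≡ 0
n≤k⇒nC[1+k]≡0 n≤k = k>n⇒nCk≡0 (s≤s n≤k)

[k+1]*[n+1]C[k+1]≡[n+1]*nCk : ∀ n k → suc k * (suc n C suc k) ≡ suc n * (n C k)
[k+1]*[n+1]C[k+1]≡[n+1]*nCk zero    zero    = refl
[k+1]*[n+1]C[k+1]≡[n+1]*nCk zero    (suc k) = *-zeroʳ (2 + k)
[k+1]*[n+1]C[k+1]≡[n+1]*nCk (suc n) zero    =
  trans (+-identityʳ _) (trans (nC1≡n (2 + n)) (sym (*-identityʳ (2 + n))))
[k+1]*[n+1]C[k+1]≡[n+1]*nCk (suc n) (suc k) = begin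
  (2 + k) * (suc (suc n) C suc (suc k))
    ≡⟨ cong ((2 + k) *_) (pascal (suc n) (suc (suc k))) ⟩
  (2 + k) * (P + Q)
    ≡⟨ regroup k P Q ⟩
  (1 + k) * P + P + (2 + k) * Q
    ≡⟨ cong₂ (λ x y → x + P + y) ([k+1]*[n+1]C[k+1]≡[n+1]*nCk n k)
                                  ([k+1]*[n+1]C[k+1]≡[n+1]*nCk n (suc k)) ⟩
  (1 + n) * c₀ + P + (1 + n) * c₁
    ≡⟨ cong (λ z → (1 + n) * c₀ + z + (1 + n) * c₁) (pascal n (suc k)) ⟩
  (1 + n) * c₀ + (c₀ + c₁) + (1 + n) * c₁
    ≡⟨ collect n c₀ c₁ ⟩
  (2 + n) * (c₀ + c₁)
    ≡⟨ cong ((2 + n) *_) (pascal n (suc k)) ⟨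
  (2 + n) * P ∎
  where
  open ≡-Reasoning
  P Q c₀ c₁ : ℕ
  P  = suc n C suc k
  Q  = suc n C suc (suc k)
  c₀ = n C k
  c₁ = n C suc k
  regroup : ∀ k x y → (2 + k) * (x + y) ≡ (1 + k) * x + x + (2 + k) * y
  regroup = solve-∀
  collect : ∀ n x y → (1 + n) * x + (x + y) + (1 + n) * y ≡ (2 + n) * (x + y)
  collect = solve-∀

[k+1]*[k+m]C[k+1]≡m*[k+m]Ck : ∀ k m → suc k * ((k + m) C suc k) ≡ m * ((k + m) C k)
[k+1]*[k+m]C[k+1]≡m*[k+m]Ck k m = +-cancelˡ-≡ (suc k * Cₖ) _ _ (begin
  suc k * Cₖ + suc k * Cₖ₊₁    ≡⟨ *-distribˡ-+ (suc k) Cₖ Cₖ₊₁ ⟨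
  suc k * (Cₖ + Cₖ₊₁)          ≡⟨ cong (suc k *_) (pascal (k + m) (suc k)) ⟨
  suc k * (suc (k + m) C suc k) ≡⟨ [k+1]*[n+1]C[k+1]≡[n+1]*nCk (k + m) k ⟩
  suc (k + m) * Cₖ              ≡⟨ *-distribʳ-+ Cₖ (suc k) m ⟩
  suc k * Cₖ + m * Cₖ           ∎)
  where
  open ≡-Reasoning
  Cₖ Cₖ₊₁ : ℕ
  Cₖ   = (k + m) C k
  Cₖ₊₁ = (k + m) C suc k

[m+1]*[k+m+1]Ck≡[k+m+1]*[k+m]Cm : ∀ k m → suc m * (suc (k + m) C k) ≡ suc (k + m) * ((k + m) C m)
[m+1]*[k+m+1]Ck≡[k+m+1]*[k+m]Cm k m = begin
  suc m * (suc (k + m) C k)             ≡⟨ cong (suc m *_) (nCk≡nC[n∸k] (m≤n⇒m≤1+n (m≤m+n k m))) ⟩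
  suc m * (suc (k + m) C (suc (k + m) ∸ k)) ≡⟨ cong (λ z → suc m * (suc (k + m) C z)) complement ⟩
  suc m * (suc (k + m) C suc m)         ≡⟨ [k+1]*[n+1]C[k+1]≡[n+1]*nCk (k + m) m ⟩
  suc (k + m) * ((k + m) C m)           ∎
  where
  open ≡-Reasoning
  complement : suc (k + m) ∸ k ≡ suc m
  complement = trans (cong (_∸ k) (sym (+-suc k m))) (m+n∸m≡n k (suc m))

narayana : ∀ k m → let n = k + m in
  suc n * ((n C k) * (n C m)) ≡ (suc n C k) * (suc n C m) + suc n * ((n C suc k) * (n C suc m))
narayana k m = *-cancelˡ-≡ _ _ (suc k * suc m) (begin
  suc k * suc m * (N * (Cₖ * Cₘ))
    ≡⟨ expand k m Cₖ Cₘ ⟩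
  (N * Cₘ) * (N * Cₖ) + N * ((m * Cₖ) * (k * Cₘ))
    ≡⟨ cong₂ (λ x y → x + N * y)
             (cong₂ _*_ ([m+1]*[k+m+1]Ck≡[k+m+1]*[k+m]Cm k m) [k+1]*[k+m+1]Cm≡[k+m+1]*[k+m]Ck)
             (cong₂ _*_ ([k+1]*[k+m]C[k+1]≡m*[k+m]Ck k m) [m+1]*[k+m]C[m+1]≡k*[k+m]Cm) ⟨
  (suc m * (N C k)) * (suc k * (N C m)) + N * ((suc k * ((k + m) C suc k)) * (suc m * ((k + m) C suc m)))
    ≡⟨ collect k m (N C k) (N C m) ((k + m) C suc k) ((k + m) C suc m) ⟩
  suc k * suc m * ((N C k) * (N C m) + N * (((k + m) C suc k) * ((k + m) C suc m))) ∎)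
  where
  open ≡-Reasoning
  N Cₖ Cₘ : ℕ
  N  = suc (k + m)
  Cₖ = (k + m) C k
  Cₘ = (k + m) C m
  [k+1]*[k+m+1]Cm≡[k+m+1]*[k+m]Ck : suc k * (N C m) ≡ N * Cₖ
  [k+1]*[k+m+1]Cm≡[k+m+1]*[k+m]Ck =
    subst (λ z → suc k * (suc z C m) ≡ suc z * (z C k)) (+-comm m k) ([m+1]*[k+m+1]Ck≡[k+m+1]*[k+m]Cm m k)
  [m+1]*[k+m]C[m+1]≡k*[k+m]Cm : suc m * ((k + m) C suc m) ≡ k * Cₘ
  [m+1]*[k+m]C[m+1]≡k*[k+m]Cm =
    subst (λ z → suc m * (z C suc m) ≡ k * (z C m)) (+-comm m k) ([k+1]*[k+m]C[k+1]≡m*[k+m]Ck m k)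
  expand : ∀ k m x y → let N = suc (k + m) in
    suc k * suc m * (N * (x * y)) ≡ (N * y) * (N * x) + N * ((m * x) * (k * y))
  expand = solve-∀
  collect : ∀ k m p q d e → let N = suc (k + m) in
    (suc m * p) * (suc k * q) + N * ((suc k * d) * (suc m * e)) ≡ suc k * suc m * (p * q + N * (d * e))
  collect = solve-∀

h+h-suc : ∀ h → suc h + suc h ≡ 2 + (h + h)
h+h-suc h = cong suc (+-suc h h)

-- The bound on n is what makes the boundary terms (a = 0 or c = 0) vanish in the induction.
#Ω-Formula : ℕ → Set
#Ω-Formula n = ∀ h a c → n ≤ h + a + c →
  #Ω n (h + h) a c + (n C suc (h + a)) * (n C suc (h + c)) ≡ (n C a) * (n C c)

#Ω-formula-●● : #Ω-Formula n → ∀ h a c → n < h + a + c →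
  #Ω-first true true n (h + h) a c + (n C suc (h + a)) * (n C suc (h + c)) ≡ (n C⁻ a) * (n C⁻ c)
#Ω-formula-●● {n} ih h zero c n<h+c =
  trans (cong₂ _+_ (#Ω-first-●-top≡0 true n (h + h) c)
                   (cong ((n C suc (h + 0)) *_) (n≤k⇒nC[1+k]≡0 n≤h+c)))
        (*-zeroʳ (n C suc (h + 0)))
  where
  n≤h+c : n ≤ h + c
  n≤h+c = <⇒≤ (subst (λ z → n < z + c) (+-identityʳ h) n<h+c)
#Ω-formula-●● {n} ih h (suc a) zero n<h+a =
  trans (cong₂ _+_ (#Ω-first-●-bottom≡0 true n (h + h) (suc a))
                   (cong (_* (n C suc (h + 0))) (n≤k⇒nC[1+k]≡0 n≤h+a)))
        (sym (*-zeroʳ (n C a)))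
  where
  n≤h+a : n ≤ h + suc a
  n≤h+a = <⇒≤ (subst (n <_) (+-identityʳ (h + suc a)) n<h+a)
#Ω-formula-●● {n} ih h (suc a) (suc c) n<h+a+c = begin
  #Ω-first true true n (h + h) (suc a) (suc c) + (n C suc (h + suc a)) * (n C suc (h + suc c))
    ≡⟨ cong₂ _+_ (#Ω-first-reduce true true n (h + h) (suc h + suc h) a c raise)
                 (cong₂ (λ x y → (n C suc x) * (n C suc y)) (+-suc h a) (+-suc h c)) ⟩
  #Ω n (suc h + suc h) a c + (n C suc (suc h + a)) * (n C suc (suc h + c))
    ≡⟨ ih (suc h) a c (≤-pred (subst (suc n ≤_) budget n<h+a+c)) ⟩
  (n C a) * (n C c) ∎
  where
  open ≡-Reasoning
  raise : ∀ p → positiveWithᵇ (h + h) (consColumn true true p) ≡ positiveWithᵇ (suc h + suc h) p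
  raise p = trans (positiveWithᵇ-●● (h + h) p) (cong (λ s → positiveWithᵇ s p) (sym (h+h-suc h)))
  budget : h + suc a + suc c ≡ suc (suc h + a + c)
  budget = trans (+-suc (h + suc a) c) (cong (λ z → suc (z + c)) (+-suc h a))

#Ω-formula-●○ : #Ω-Formula n → ∀ h a c → n < h + a + c →
  #Ω-first true false n (h + h) a c + (n C (h + a)) * (n C suc (h + c)) ≡ (n C⁻ a) * (n C c)
#Ω-formula-●○ {n} ih h zero c n<h+c =
  trans (cong₂ _+_ (#Ω-first-●-top≡0 false n (h + h) c)
                   (cong ((n C (h + 0)) *_) (n≤k⇒nC[1+k]≡0 n≤h+c)))
        (*-zeroʳ (n C (h + 0)))
  where
  n≤h+c : n ≤ h + c
  n≤h+c = <⇒≤ (subst (λ z → n < z + c) (+-identityʳ h) n<h+c)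
#Ω-formula-●○ {n} ih h (suc a) c n<h+a+c = begin
  #Ω-first true false n (h + h) (suc a) c + (n C (h + suc a)) * (n C suc (h + c))
    ≡⟨ cong₂ _+_ (#Ω-first-reduce true false n (h + h) (h + h) a c (positiveWithᵇ-●○ (h + h)))
                 (cong (λ x → (n C x) * (n C suc (h + c))) (+-suc h a)) ⟩
  #Ω n (h + h) a c + (n C suc (h + a)) * (n C suc (h + c))
    ≡⟨ ih h a c (≤-pred (subst (suc n ≤_) (cong (_+ c) (+-suc h a)) n<h+a+c)) ⟩
  (n C a) * (n C c) ∎
  where open ≡-Reasoning

#Ω-formula-○● : #Ω-Formula n → ∀ h a c → n < h + a + c →
  #Ω-first false true n (h + h) a c + (n C suc (h + a)) * (n C (h + c)) ≡ (n C a) * (n C⁻ c)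
#Ω-formula-○● {n} ih h a zero n<h+a =
  trans (cong₂ _+_ (#Ω-first-●-bottom≡0 false n (h + h) a)
                   (cong (_* (n C (h + 0))) (n≤k⇒nC[1+k]≡0 n≤h+a)))
        (sym (*-zeroʳ (n C a)))
  where
  n≤h+a : n ≤ h + a
  n≤h+a = <⇒≤ (subst (n <_) (+-identityʳ (h + a)) n<h+a)
#Ω-formula-○● {n} ih h a (suc c) n<h+a+c = begin
  #Ω-first false true n (h + h) a (suc c) + (n C suc (h + a)) * (n C (h + suc c))
    ≡⟨ cong₂ _+_ (#Ω-first-reduce false true n (h + h) (h + h) a c (positiveWithᵇ-○● (h + h)))
                 (cong (λ y → (n C suc (h + a)) * (n C y)) (+-suc h c)) ⟩
  #Ω n (h + h) a c + (n C suc (h + a)) * (n C suc (h + c))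
    ≡⟨ ih h a c (≤-pred (subst (suc n ≤_) (+-suc (h + a) c) n<h+a+c)) ⟩
  (n C a) * (n C c) ∎
  where open ≡-Reasoning

#Ω-formula-○○ : #Ω-Formula n → ∀ h a c → n < h + a + c →
  #Ω-first false false n (h + h) a c + (n C (h + a)) * (n C (h + c)) ≡ (n C a) * (n C c)
#Ω-formula-○○ {n} ih zero    a c _         = cong (_+ (n C a) * (n C c)) (#Ω-first-○○≡0 n a c)
#Ω-formula-○○ {n} ih (suc h) a c n<h+a+c = begin
  #Ω-first false false n (suc h + suc h) a c + (n C suc (h + a)) * (n C suc (h + c))
    ≡⟨ cong (_+ (n C suc (h + a)) * (n C suc (h + c)))
            (#Ω-first-reduce false false n (suc h + suc h) (h + h) a c lower) ⟩
  #Ω n (h + h) a c + (n C suc (h + a)) * (n C suc (h + c))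
    ≡⟨ ih h a c (≤-pred n<h+a+c) ⟩
  (n C a) * (n C c) ∎
  where
  open ≡-Reasoning
  lower : ∀ p → positiveWithᵇ (suc h + suc h) (consColumn false false p) ≡ positiveWithᵇ (h + h) p
  lower p = trans (cong (λ s → positiveWithᵇ s (consColumn false false p)) (h+h-suc h))
                  (positiveWithᵇ-○○ (h + h) p)

#Ω-formula : ∀ n → #Ω-Formula n
#Ω-formula zero    h zero    zero    _ = refl
#Ω-formula zero    h zero    (suc c) _ = refl
#Ω-formula zero    h (suc a) c       _ = refl
#Ω-formula (suc n) h a c n<h+a+c = begin
  #Ω (suc n) (h + h) a c + (suc n C suc (h + a)) * (suc n C suc (h + c))
    ≡⟨ cong₂ _+_ (#Ω-suc n (h + h) a c) (cong₂ _*_ (pascal n (suc (h + a))) (pascal n (suc (h + c)))) ⟩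
  ●● + ●○ + ○● + ○○ + (A₀ + A₁) * (C₀ + C₁)
    ≡⟨ distribute ●● ●○ ○● ○○ A₀ A₁ C₀ C₁ ⟩
  (●● + A₁ * C₁) + (●○ + A₀ * C₁) + (○● + A₁ * C₀) + (○○ + A₀ * C₀)
    ≡⟨ cong₂ _+_ (cong₂ _+_ (cong₂ _+_ (#Ω-formula-●● ih h a c n<h+a+c)
                                       (#Ω-formula-●○ ih h a c n<h+a+c))
                            (#Ω-formula-○● ih h a c n<h+a+c))
                 (#Ω-formula-○○ ih h a c n<h+a+c) ⟩
  (n C⁻ a) * (n C⁻ c) + (n C⁻ a) * (n C c) + (n C a) * (n C⁻ c) + (n C a) * (n C c)
    ≡⟨ factorise (n C⁻ a) (n C a) (n C⁻ c) (n C c) ⟩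
  (n C⁻ a + n C a) * (n C⁻ c + n C c)
    ≡⟨ cong₂ _*_ (pascal n a) (pascal n c) ⟨
  (suc n C a) * (suc n C c) ∎
  where
  open ≡-Reasoning
  ih : #Ω-Formula n
  ih = #Ω-formula n
  ●● ●○ ○● ○○ A₀ A₁ C₀ C₁ : ℕ
  ●● = #Ω-first true true n (h + h) a c
  ●○ = #Ω-first true false n (h + h) a c
  ○● = #Ω-first false true n (h + h) a c
  ○○ = #Ω-first false false n (h + h) a c
  A₀ = n C (h + a)
  A₁ = n C suc (h + a)
  C₀ = n C (h + c)
  C₁ = n C suc (h + c)
  distribute : ∀ w x y z a₀ a₁ c₀ c₁ → w + x + y + z + (a₀ + a₁) * (c₀ + c₁)
             ≡ (w + a₁ * c₁) + (x + a₀ * c₁) + (y + a₁ * c₀) + (z + a₀ * c₀)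
  distribute = solve-∀
  factorise : ∀ x₀ x₁ y₀ y₁ → x₀ * y₀ + x₀ * y₁ + x₁ * y₀ + x₁ * y₁ ≡ (x₀ + x₁) * (y₀ + y₁)
  factorise = solve-∀

#Ω-balanced : ∀ k m → suc (k + m) * #Ω (k + m) 0 k m ≡ (suc (k + m) C k) * (suc (k + m) C m)
#Ω-balanced k m = +-cancelʳ-≡ (N * D) _ _ (begin
  N * g + N * D                     ≡⟨ *-distribˡ-+ N g D ⟨
  N * (g + D)                       ≡⟨ cong (N *_) (#Ω-formula (k + m) 0 k m ≤-refl) ⟩
  N * (((k + m) C k) * ((k + m) C m)) ≡⟨ narayana k m ⟩
  (N C k) * (N C m) + N * D         ∎)
  where
  open ≡-Reasoning
  N g D : ℕ
  N = suc (k + m)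
  g = #Ω (k + m) 0 k m
  D = ((k + m) C suc k) * ((k + m) C suc m)

blacks+whites : (v : Vec Colour n) → blacks v + whites v ≡ n
blacks+whites []          = refl
blacks+whites (true ∷ v)  = cong suc (blacks+whites v)
blacks+whites (false ∷ v) = trans (+-suc (blacks v) (whites v)) (cong suc (blacks+whites v))

blacks≡⇒whites≡ : ∀ {k m} (v : Vec Colour n) → k + m ≡ n → blacks v ≡ k → whites v ≡ m
blacks≡⇒whites≡ {k = k} v k+m≡n refl = +-cancelˡ-≡ k _ _ (trans (blacks+whites v) (sym k+m≡n))

whites≡ᵇ⇔blacks≡ᵇ : ∀ {k m} (v : Vec Colour n) → k + m ≡ n → (whites v ≡ᵇ m) ≡ (blacks v ≡ᵇ k)
whites≡ᵇ⇔blacks≡ᵇ {k = k} {m} v k+m≡n =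
  does-⇔ (mk⇔ whites≡⇒blacks≡ (blacks≡⇒whites≡ v k+m≡n)) (whites v ≟ m) (blacks v ≟ k)
  where
  whites≡⇒blacks≡ : whites v ≡ m → blacks v ≡ k
  whites≡⇒blacks≡ refl = +-cancelʳ-≡ m _ _ (trans (blacks+whites v) (sym k+m≡n))

balanced : ∀ {k m} (t b : Vec Colour n) → k + m ≡ n → blacks t ≡ k → blacks b ≡ m →
           blacks t + blacks b ≡ whites t + whites b
balanced {n = n} {k = k} {m} t b k+m≡n refl refl = begin
  k + m                 ≡⟨ +-comm k m ⟩
  m + k                 ≡⟨ cong₂ _+_ (blacks≡⇒whites≡ t k+m≡n refl) (blacks≡⇒whites≡ b m+k≡n refl) ⟨
  whites t + whites b   ∎
  where
  open ≡-Reasoning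
  m+k≡n : m + k ≡ n
  m+k≡n = trans (+-comm m k) k+m≡n

inΩ⁰ᵇ≡inΩᵇ : ∀ {k m} → k + m ≡ n → (p : Config n) → inΩ⁰ᵇ k m p ≡ inΩᵇ 0 k m p
inΩ⁰ᵇ≡inΩᵇ {k = k} {m} k+m≡n (t , b) = begin
  (blacks t ≡ᵇ k) ∧ (whites t ≡ᵇ m) ∧ (blacks b ≡ᵇ m) ∧ (whites b ≡ᵇ k) ∧ β ∧ positiveᵇ (t , b)
    ≡⟨ cong₂ (λ x y → (blacks t ≡ᵇ k) ∧ x ∧ (blacks b ≡ᵇ m) ∧ y ∧ β ∧ positiveᵇ (t , b))
             (whites≡ᵇ⇔blacks≡ᵇ t k+m≡n) (whites≡ᵇ⇔blacks≡ᵇ b (trans (+-comm m k) k+m≡n)) ⟩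
  (blacks t ≡ᵇ k) ∧ (blacks t ≡ᵇ k) ∧ (blacks b ≡ᵇ m) ∧ (blacks b ≡ᵇ m) ∧ β ∧ positiveᵇ (t , b)
    ≡⟨ ∧-redundant (blacks t ≡ᵇ k) (blacks b ≡ᵇ m) (positiveᵇ (t , b)) (λ top bottom →
         ≡⇒≡ᵇ _ _ (balanced t b k+m≡n (≡ᵇ⇒≡ _ _ top) (≡ᵇ⇒≡ _ _ bottom))) ⟩
  (blacks t ≡ᵇ k) ∧ (blacks b ≡ᵇ m) ∧ positiveᵇ (t , b)
    ≡⟨ cong (λ z → (blacks t ≡ᵇ k) ∧ (blacks b ≡ᵇ m) ∧ z) (positiveᵇ≡positiveWithᵇ0 (t , b)) ⟩
  inΩᵇ 0 k m (t , b) ∎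
  where
  open ≡-Reasoning
  β : Bool
  β = blacks t + blacks b ≡ᵇ whites t + whites b

lemma2 : (k m n : ℕ) → k + m ≡ n →
    countΩ⁰ n k m ≡ ((suc n C k) * (suc n C m)) / suc n
lemma2 k m n refl = begin
  countΩ⁰ n k m                              ≡⟨ countΩ⁰≡Σconfigs n k m ⟩
  Σconfigs n (𝟙 ∘ inΩ⁰ᵇ k m)                 ≡⟨ Σconfigs-cong (cong 𝟙 ∘ inΩ⁰ᵇ≡inΩᵇ {k = k} {m} refl) ⟩
  #Ω n 0 k m                                 ≡⟨ m*n/n≡m (#Ω n 0 k m) (suc n) ⟨
  (#Ω n 0 k m * suc n) / suc n               ≡⟨ cong (_/ suc n) (trans (*-comm _ (suc n)) (#Ω-balanced k m)) ⟩
  ((suc n C k) * (suc n C m)) / suc n        ∎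
  where open ≡-Reasoning
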